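{- Let $n,k,i,j$ be integers with $1\le k\le n$ and $i,j\ge0$. Then $$[u^iv^j]\,S(n,k;u,v)=\left|\{\pi\in\mathrm{LLP}_{n,k}:\mathrm{nsb}(\pi)=i\text{ and }\mathrm{nse}(\pi)=j\}\right|=\left[ {n\atop n-j}\right]\left\{ {n-j\atop k}\right\}\left[ {k\atop k-i}\right].$$
   Context: $[n]=\{1,\dots,n\}$. $\mathrm{LLP}_{n,k}$ is the set of partitions of $[n]$ into $k$ nonempty blocks where the blocks are linearly ordered $(B_1,\dots,B_k)$ and each block is a linear list of its elements. For $\pi\in\mathrm{LLP}_{n,k}$: the label of a block is its smallest element; $\mathrm{nsb}(\pi)$ is the number of blocks that must be moved to the right in order to arrange the blocks in increasing order of labels, i.e. the number of positions $r$ such that the label of $B_r$ exceeds the label of some $B_s$ with $s>r$; $\mathrm{nse}(\pi)$ is the total, over all blocks, of the number of elements that must be moved to the right within their block to make the block increasing, i.e. the number of entries of a list having some smaller entry to their right in the same list. Define $S(n,k;u,v)=\sum_{\pi\in\mathrm{LLP}_{n,k}}u^{\mathrm{nsb}(\pi)}v^{\mathrm{nse}(\pi)}$. $\left[ {a\atop b}\right]$ denotes the unsigned Stirling number of the first kind and $\left\{ {a\atop b}\right\}$ the Stirling number of the second kind. -}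

module Defs where

open import Data.Nat using (ℕ; zero; suc; _+_; _*_; _<?_; _⊓_)
open import Data.List using (List; []; _∷_; length; map; concat; foldr; upTo)
open import Data.Nat.ListAction using (sum)
open import Data.List.Relation.Unary.Any using (any?)
open import Data.List.Relation.Unary.All using (All)
open import Data.List.Relation.Binary.Permutation.Propositional using (_↭_)
open import Data.Product using (_×_)
open import Data.Empty using (⊥)
open import Data.Unit using (⊤)
open import Relation.Binary.PropositionalEquality using (_≡_)
open import Relation.Nullary.Decidable using (⌊_⌋)
open import Data.Bool using (if_then_else_)

range1 : ℕ → List ℕ
range1 n = map suc (upTo n)

NonEmpty : List ℕ → Set
NonEmpty []      = ⊥
NonEmpty (_ ∷ _) = ⊤

-- A linear-list partition of [n] into k blocks: a list (B₁,…,B_k) of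
-- nonempty lists, whose concatenation is a permutation of [n]
-- (so the blocks are pairwise disjoint, nonempty, and cover [n]).
IsLLP : ℕ → ℕ → List (List ℕ) → Set
IsLLP n k π = (length π ≡ k) × All NonEmpty π × (concat π ↭ range1 n)

nMoved : List ℕ → ℕ
nMoved []       = 0
nMoved (x ∷ xs) = (if ⌊ any? (_<? x) xs ⌋ then 1 else 0) + nMoved xs

label : List ℕ → ℕ
label []       = 0
label (x ∷ xs) = foldr _⊓_ x xs

nsb : List (List ℕ) → ℕ
nsb π = nMoved (map label π)

nse : List (List ℕ) → ℕ
nse π = sum (map nMoved π)

stirling1 : ℕ → ℕ → ℕ
stirling1 zero    zero    = 1
stirling1 zero    (suc k) = 0
stirling1 (suc n) zero    = 0
stirling1 (suc n) (suc k) = n * stirling1 n (suc k) + stirling1 n k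

stirling2 : ℕ → ℕ → ℕ
stirling2 zero    zero    = 1
stirling2 zero    (suc k) = 0
stirling2 (suc n) zero    = 0
stirling2 (suc n) (suc k) = suc k * stirling2 n (suc k) + stirling2 n k

module Submission where

-- Every LLP of [n+1] arises in exactly one way from an LLP of [n] by adding n+1,
-- either as a new singleton block at one of the a+1 positions among the a blocks,
-- or inside one of the blocks at one of the n positions before an entry or at the
-- end of one of the a blocks. Since n+1 exceeds every entry and every label, the
-- statistics change predictably: (a, b, c) has a children (a+1, b+1, c), one child
-- (a+1, b, c), n children (a, b, c+1) and a children (a, b, c).
--
-- The closed form
-- [n, n-j] {n-j, k} [k, k-i] obeys the same recurrence (via the Stirling recurrences),
-- and the theorem filters llps n by the statistics (k, i, j).

open import Defs
open import Data.Nat using (ℕ; zero; suc; _+_; _*_; _∸_; _≤_; _<_; _⊓_; _<?_; _≤?_; _≟_; s≤s; z≤n)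
open import Data.Nat.Properties hiding (_≟_)
open import Data.Nat.ListAction.Properties using (sum-↭)
open import Data.Bool using (Bool; if_then_else_)
open import Data.List using (List; []; _∷_; [_]; _++_; length; map; concat; concatMap; replicate; filter; upTo; _∷ʳ_; foldr)
import Data.List.Properties as List
open import Data.List.Properties using (map-∘; map-++; map-replicate; length-map; length-++; length-upTo; upTo-∷ʳ; map-cong-local; ∷-injectiveˡ; ∷-injectiveʳ)
open import Data.List.Membership.Propositional using (_∈_; _∉_)
open import Data.List.Membership.Propositional.Properties
open import Data.List.Membership.DecPropositional _≟_ using (_∈?_)
open import Data.List.Relation.Unary.Any using (Any; here; there; any?)
open import Data.List.Relation.Unary.All using (All; []; _∷_)
import Data.List.Relation.Unary.All as All
import Data.List.Relation.Unary.All.Properties as All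
open import Data.List.Relation.Unary.Unique.Propositional using (Unique)
import Data.List.Relation.Unary.Unique.Propositional.Properties as Unique
open import Data.List.Relation.Unary.AllPairs using ([]; _∷_)
open import Data.List.Relation.Binary.Permutation.Propositional using (_↭_; ↭-refl; ↭-sym; ↭-trans; prep; swap; module PermutationReasoning)
open import Data.List.Relation.Binary.Permutation.Propositional.Properties hiding (sum-↭)
open import Data.Product using (Σ; _×_; _,_; proj₁; proj₂)
open import Data.Product.Properties using (≡-dec)
open import Data.Nat.Tactic.RingSolver using (solve-∀)
open import Data.Sum using (_⊎_; inj₁; inj₂)
open import Data.Unit using (tt)
open import Function using (_∘_)
open import Function.Bundles using (_⇔_; mk⇔; Equivalence)
open import Relation.Nullary using (¬_; Dec; yes; no; contradiction)
open import Relation.Nullary.Decidable using (⌊_⌋; fromWitness)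
open import Data.Bool.Properties using (T-≡)
open import Relation.Binary.PropositionalEquality hiding ([_])
open import Relation.Binary.Definitions using (DecidableEquality)

variable
  A B : Set

insertions : A → List A → List (List A)
insertions y []      = [ y ∷ [] ]
insertions y (z ∷ l) = (y ∷ z ∷ l) ∷ map (z ∷_) (insertions y l)

insertions-↭ : ∀ {y : A} l {ρ} → ρ ∈ insertions y l → ρ ↭ y ∷ l
insertions-↭ []      (here refl) = ↭-refl
insertions-↭ (z ∷ l) (here refl) = ↭-refl
insertions-↭ {y = y} (z ∷ l) (there p) with ∈-map⁻ (z ∷_) p
... | r , r∈ , refl = ↭-trans (prep z (insertions-↭ l r∈)) (swap z y ↭-refl)

head∈insertions : (y : A) (l : List A) → (y ∷ l) ∈ insertions y l
head∈insertions y []      = here refl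
head∈insertions y (_ ∷ _) = here refl

insertions-unique : ∀ {y : A} l → y ∉ l → Unique (insertions y l)
insertions-unique []              _  = [] ∷ []
insertions-unique {y = y} (z ∷ l) y∉ =
  All.tabulate front≢ ∷ Unique.map⁺ ∷-injectiveʳ (insertions-unique l (y∉ ∘ there))
  where
  front≢ : ∀ {v} → v ∈ map (z ∷_) (insertions y l) → (y ∷ z ∷ l) ≢ v
  front≢ v∈ eq with ∈-map⁻ (z ∷_) v∈
  ... | _ , _ , refl = y∉ (here (∷-injectiveˡ eq))

insertions-map : (f : A → B) (y : A) (l : List A) →
  map (map f) (insertions y l) ≡ insertions (f y) (map f l)
insertions-map f y []      = refl
insertions-map f y (z ∷ l) = cong ((f y ∷ f z ∷ map f l) ∷_) (begin
  map (map f) (map (z ∷_) (insertions y l)) ≡⟨ sym (map-∘ (insertions y l)) ⟩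
  map (λ r → f z ∷ map f r) (insertions y l) ≡⟨ map-∘ (insertions y l) ⟩
  map (f z ∷_) (map (map f) (insertions y l)) ≡⟨ cong (map (f z ∷_)) (insertions-map f y l) ⟩
  map (f z ∷_) (insertions (f y) (map f l)) ∎)
  where open ≡-Reasoning

map-replicate-∷ʳ : (f : A → B) (k : ℕ) (a b : A) →
  map f (replicate k a ++ [ b ]) ≡ replicate k (f a) ++ [ f b ]
map-replicate-∷ʳ f k a b = trans (map-++ f (replicate k a) [ b ]) (cong (_++ [ f b ]) (map-replicate f k a))

replicate-+ : (p q : ℕ) (z : A) → replicate (p + q) z ≡ replicate p z ++ replicate q z
replicate-+ zero    q z = refl
replicate-+ (suc p) q z = cong (z ∷_) (replicate-+ p q z)

regroup : (p q r : ℕ) (X Y : A) →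
  replicate p X ++ Y ∷ (replicate q X ++ replicate r Y) ↭ replicate (p + q) X ++ replicate (suc r) Y
regroup p q r X Y = begin
  replicate p X ++ Y ∷ (replicate q X ++ replicate r Y)   ↭⟨ ++⁺ˡ (replicate p X) (↭-sym (shift Y (replicate q X) _)) ⟩
  replicate p X ++ (replicate q X ++ replicate (suc r) Y) ≡⟨ sym (List.++-assoc (replicate p X) _ _) ⟩
  (replicate p X ++ replicate q X) ++ replicate (suc r) Y ≡⟨ cong (_++ replicate (suc r) Y) (sym (replicate-+ p q X)) ⟩
  replicate (p + q) X ++ replicate (suc r) Y              ∎
  where open PermutationReasoning

concat-↭ : {xss yss : List (List A)} → xss ↭ yss → concat xss ↭ concat yss
concat-↭ _↭_.refl         = ↭-refl
concat-↭ (prep xs p)      = ++⁺ˡ xs (concat-↭ p)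
concat-↭ (swap xs ys p)   = ↭-trans (shifts xs ys) (++⁺ˡ ys (++⁺ˡ xs (concat-↭ p)))
concat-↭ (_↭_.trans p q)  = ↭-trans (concat-↭ p) (concat-↭ q)

concatMap-unique : (f : A → List B) (G : List A) → Unique G → (∀ {a} → a ∈ G → Unique (f a)) →
  (∀ {a a' b} → a ∈ G → a' ∈ G → b ∈ f a → b ∈ f a' → a ≡ a') → Unique (concatMap f G)
concatMap-unique f []      _            _       _   = []
concatMap-unique f (a ∷ G) (a∉G ∷ uniq) uniq-f  det =
  Unique.++⁺ (uniq-f (here refl))
             (concatMap-unique f G uniq (uniq-f ∘ there) (λ p q → det (there p) (there q)))
             disjoint
  where
  disjoint : ∀ {v} → ¬ (v ∈ f a × v ∈ concatMap f G)
  disjoint (p , q) with ∈-concat⁻′ (map f G) q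
  ... | R , v∈R , R∈ with ∈-map⁻ f R∈
  ...   | a' , a'∈ , refl = All.lookup a∉G a'∈ (det (here refl) (there a'∈) p v∈R)

⌊⌋-⇔ : {P Q : Set} (p? : Dec P) (q? : Dec Q) → (P → Q) → (Q → P) → ⌊ p? ⌋ ≡ ⌊ q? ⌋
⌊⌋-⇔ (yes _) (yes _) _   _   = refl
⌊⌋-⇔ (no _)  (no _)  _   _   = refl
⌊⌋-⇔ (yes p) (no ¬q) p→q _   = contradiction (p→q p) ¬q
⌊⌋-⇔ (no ¬p) (yes q) _   q→p = contradiction (q→p q) ¬p

weighted : (A → ℕ) → List (ℕ × A) → ℕ
weighted f []             = 0
weighted f ((w , τ) ∷ ps) = w * f τ + weighted f ps

weighted-++ : ∀ (f : A → ℕ) ps qs → weighted f (ps ++ qs) ≡ weighted f ps + weighted f qs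
weighted-++ f []             qs = refl
weighted-++ f ((w , τ) ∷ ps) qs = trans (cong (w * f τ +_) (weighted-++ f ps qs)) (sym (+-assoc (w * f τ) _ _))

weighted-cong : ∀ {f g : A → ℕ} → (∀ u → f u ≡ g u) → ∀ ps → weighted f ps ≡ weighted g ps
weighted-cong f≗g []             = refl
weighted-cong f≗g ((w , τ) ∷ ps) = cong₂ (λ x y → w * x + y) (f≗g τ) (weighted-cong f≗g ps)

weighted-zero : ∀ (ps : List (ℕ × A)) → weighted (λ _ → 0) ps ≡ 0
weighted-zero []             = refl
weighted-zero ((w , _) ∷ ps) = cong₂ _+_ (*-zeroʳ w) (weighted-zero ps)

weighted-+ : ∀ (f g : A → ℕ) ps → weighted (λ u → f u + g u) ps ≡ weighted f ps + weighted g ps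
weighted-+ f g []             = refl
weighted-+ f g ((w , τ) ∷ ps) rewrite weighted-+ f g ps = distribute w (f τ) (g τ) (weighted f ps) (weighted g ps)
  where
  distribute : ∀ w x y F G → w * (x + y) + (F + G) ≡ w * x + F + (w * y + G)
  distribute = solve-∀

module Multiplicity {A : Set} (_≟ᴬ_ : DecidableEquality A) where

  count : A → List A → ℕ
  count a xs = length (filter (_≟ᴬ a) xs)

  count-++ : ∀ a xs ys → count a (xs ++ ys) ≡ count a xs + count a ys
  count-++ a xs ys = trans (cong length (List.filter-++ (_≟ᴬ a) xs ys)) (length-++ (filter (_≟ᴬ a) xs))

  count-↭ : ∀ a {xs ys} → xs ↭ ys → count a xs ≡ count a ys
  count-↭ a p = ↭-length (filter-↭ (_≟ᴬ a) p)

  count-replicate : ∀ a m x → count a (replicate m x) ≡ m * count a [ x ]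
  count-replicate a zero    x = refl
  count-replicate a (suc m) x = trans (count-++ a [ x ] (replicate m x)) (cong (count a [ x ] +_) (count-replicate a m x))

  count-map : {X : Set} (f : X → A) (G : List X) → ∀ a →
    length (filter (λ g → f g ≟ᴬ a) G) ≡ count a (map f G)
  count-map f []      a = refl
  count-map f (g ∷ G) a with f g ≟ᴬ a
  ... | yes _ = cong suc (count-map f G a)
  ... | no _  = count-map f G a

  count-single-≢ : ∀ {x a} → x ≢ a → count a [ x ] ≡ 0
  count-single-≢ {x} {a} x≢a with x ≟ᴬ a
  ... | yes x≡a = contradiction x≡a x≢a
  ... | no _    = refl

  count-single-≡ : ∀ x → count x [ x ] ≡ 1
  count-single-≡ x with x ≟ᴬ x
  ... | yes _   = refl
  ... | no x≢x  = contradiction refl x≢x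

  -- A weight can be read off at either argument, since the count vanishes unless x ≡ a.
  count-single-weight : (w : A → ℕ) (x a : A) → w x * count a [ x ] ≡ w a * count a [ x ]
  count-single-weight w x a with x ≟ᴬ a
  ... | yes refl = refl
  ... | no _     = trans (*-zeroʳ (w x)) (sym (*-zeroʳ (w a)))

  count-single-injective : (f : A → A) → (∀ {x y} → f x ≡ f y → x ≡ y) → ∀ x a →
    count (f a) [ f x ] ≡ count a [ x ]
  count-single-injective f f-inj x a = by-cases (x ≟ᴬ a)
    where
    by-cases : Dec (x ≡ a) → count (f a) [ f x ] ≡ count a [ x ]
    by-cases (yes refl) = trans (count-single-≡ (f x)) (sym (count-single-≡ x))
    by-cases (no x≢a)   = trans (count-single-≢ (x≢a ∘ f-inj)) (sym (count-single-≢ x≢a))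

  count-concatMap : {X : Set} (F : X → List A) (s : X → A) (ps : A → List (ℕ × A)) (G : List X) →
    (∀ {g} → g ∈ G → ∀ t → count t (F g) ≡ weighted (λ u → count u [ s g ]) (ps t)) →
    ∀ t → count t (concatMap F G) ≡ weighted (λ u → count u (map s G)) (ps t)
  count-concatMap F s ps []      _    t = sym (weighted-zero (ps t))
  count-concatMap F s ps (g ∷ G) rule t = begin
    count t (F g ++ concatMap F G)                         ≡⟨ count-++ t (F g) _ ⟩
    count t (F g) + count t (concatMap F G)
      ≡⟨ cong₂ _+_ (rule (here refl) t) (count-concatMap F s ps G (rule ∘ there) t) ⟩
    weighted (λ u → count u [ s g ]) (ps t) + weighted (λ u → count u (map s G)) (ps t)
      ≡⟨ sym (weighted-+ (λ u → count u [ s g ]) (λ u → count u (map s G)) (ps t)) ⟩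
    weighted (λ u → count u [ s g ] + count u (map s G)) (ps t)
      ≡⟨ weighted-cong (λ u → sym (count-++ u [ s g ] (map s G))) (ps t) ⟩
    weighted (λ u → count u (s g ∷ map s G)) (ps t)        ∎
    where open ≡-Reasoning

-- Whether l has an entry smaller than y: an entry y followed by l contributes
-- exactly this bit to nMoved.
hasSmaller : ℕ → List ℕ → Bool
hasSmaller y l = ⌊ any? (_<? y) l ⌋

hasSmaller-↭ : ∀ y {l l'} → l ↭ l' → hasSmaller y l ≡ hasSmaller y l'
hasSmaller-↭ y {l} {l'} p = ⌊⌋-⇔ (any? (_<? y) l) (any? (_<? y) l') (Any-resp-↭ p) (Any-resp-↭ (↭-sym p))

hasSmaller-large : ∀ {y x} l → y ≤ x → hasSmaller y (x ∷ l) ≡ hasSmaller y l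
hasSmaller-large {y} {x} l y≤x = ⌊⌋-⇔ (any? (_<? y) (x ∷ l)) (any? (_<? y) l) drop there
  where
  drop : Any (_< y) (x ∷ l) → Any (_< y) l
  drop (here x<y) = contradiction y≤x (<⇒≱ x<y)
  drop (there a)  = a

-- Inserting an entry x larger than all entries of L: at each of the first |L|
-- positions x is followed by a smaller entry (one more moved entry), at the last
-- position it is not; the entries of L keep their status since x is not smaller.
nMoved-insertions : ∀ {x} L → All (_< x) L →
  map nMoved (insertions x L) ≡ replicate (length L) (suc (nMoved L)) ++ [ nMoved L ]
nMoved-insertions []                 []             = refl
nMoved-insertions {x} (z ∷ L) (z<x ∷ L<x) = cong₂ _∷_ front (begin
  map nMoved (map (z ∷_) (insertions x L))             ≡⟨ sym (map-∘ (insertions x L)) ⟩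
  map (λ r → nMoved (z ∷ r)) (insertions x L)          ≡⟨ map-cong-local (All.tabulate unchanged) ⟩
  map (λ r → c + nMoved r) (insertions x L)            ≡⟨ map-∘ (insertions x L) ⟩
  map (c +_) (map nMoved (insertions x L))             ≡⟨ cong (map (c +_)) (nMoved-insertions L L<x) ⟩
  map (c +_) (replicate (length L) (suc m) ++ [ m ])   ≡⟨ map-replicate-∷ʳ (c +_) (length L) (suc m) m ⟩
  replicate (length L) (c + suc m) ++ [ c + m ]        ≡⟨ cong (λ w → replicate (length L) w ++ [ c + m ]) (+-suc c m) ⟩
  replicate (length L) (suc (c + m)) ++ [ c + m ]      ∎)
  where
  open ≡-Reasoning
  m c : ℕ
  m = nMoved L
  c = if hasSmaller z L then 1 else 0
  front : nMoved (x ∷ z ∷ L) ≡ suc (nMoved (z ∷ L))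
  front = cong (λ b → (if b then 1 else 0) + nMoved (z ∷ L))
                (Equivalence.to T-≡ (fromWitness {a? = any? (_<? x) (z ∷ L)} (here z<x)))
  unchanged : ∀ {r} → r ∈ insertions x L → nMoved (z ∷ r) ≡ c + nMoved r
  unchanged {r} r∈ = cong (λ b → (if b then 1 else 0) + nMoved r)
    (trans (hasSmaller-↭ z (insertions-↭ L r∈)) (hasSmaller-large L (<⇒≤ z<x)))

foldr-⊓-sel : ∀ y zs → foldr _⊓_ y zs ≡ y ⊎ foldr _⊓_ y zs ∈ zs
foldr-⊓-sel y []       = inj₁ refl
foldr-⊓-sel y (z ∷ zs) with ⊓-sel z (foldr _⊓_ y zs) | foldr-⊓-sel y zs
... | inj₁ eq | _        = inj₂ (here eq)
... | inj₂ eq | inj₁ eq' = inj₁ (trans eq eq')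
... | inj₂ eq | inj₂ m∈  = inj₂ (there (subst (_∈ zs) (sym eq) m∈))

label-∈ : ∀ y ys → label (y ∷ ys) ∈ y ∷ ys
label-∈ y ys with foldr-⊓-sel y ys
... | inj₁ eq = here eq
... | inj₂ m∈ = there m∈

label-lower : ∀ y ys → All (label (y ∷ ys) ≤_) (y ∷ ys)
label-lower y ys = proj₁ (bounds ys) ∷ proj₂ (bounds ys)
  where
  bounds : ∀ zs → foldr _⊓_ y zs ≤ y × All (foldr _⊓_ y zs ≤_) zs
  bounds []       = ≤-refl , []
  bounds (z ∷ zs) = ≤-trans (m⊓n≤n z _) (proj₁ (bounds zs))
                  , m⊓n≤m z _ ∷ All.map (≤-trans (m⊓n≤n z _)) (proj₂ (bounds zs))

label-unique : ∀ {m} l → m ∈ l → All (m ≤_) l → label l ≡ m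
label-unique (y ∷ ys) m∈ m≤ =
  ≤-antisym (All.lookup (label-lower y ys) m∈) (All.lookup m≤ (label-∈ y ys))

label-insertions : ∀ {x} y ys → y ≤ x → {B' : List ℕ} → B' ∈ insertions x (y ∷ ys) →
  label B' ≡ label (y ∷ ys)
label-insertions {x} y ys y≤x {B'} B'∈ = label-unique B'
  (∈-resp-↭ (↭-sym B'↭) (there (label-∈ y ys)))
  (All-resp-↭ (↭-sym B'↭) (≤-trans (All.lookup (label-lower y ys) (here refl)) y≤x ∷ label-lower y ys))
  where
  B'↭ : B' ↭ x ∷ y ∷ ys
  B'↭ = insertions-↭ (y ∷ ys) B'∈

LLP : ℕ → List (List ℕ) → Set
LLP n π = All NonEmpty π × (concat π ↭ range1 n)

Below : ℕ → List (List ℕ) → Set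
Below x π = All (_< x) (concat π)

range1-suc : ∀ n → suc n ∷ range1 n ↭ range1 (suc n)
range1-suc n = subst (suc n ∷ range1 n ↭_) snoc (∷↭∷ʳ (suc n) (range1 n))
  where
  snoc : range1 n ∷ʳ suc n ≡ range1 (suc n)
  snoc = trans (sym (map-++ suc (upTo n) [ n ])) (cong (map suc) (upTo-∷ʳ n))

LLP⇒Below : ∀ {n π} → LLP n π → Below (suc n) π
LLP⇒Below (_ , π↭) = All-resp-↭ (↭-sym π↭) (All.tabulate below)
  where
  below : ∀ {y} → y ∈ range1 _ → y < suc _
  below y∈ with ∈-map⁻ suc y∈
  ... | z , z∈ , refl = s≤s (∈-upTo⁻ z∈)

intoBlocks : ℕ → List (List ℕ) → List (List (List ℕ))
intoBlocks x []      = []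
intoBlocks x (B ∷ π) = map (_∷ π) (insertions x B) ++ map (B ∷_) (intoBlocks x π)

extensions : ℕ → List (List ℕ) → List (List (List ℕ))
extensions x π = insertions [ x ] π ++ intoBlocks x π

-- The list of all LLPs of [n]: every LLP of [n+1] arises from one of [n] by adding n+1.
llps : ℕ → List (List (List ℕ))
llps zero    = [ [] ]
llps (suc n) = concatMap (extensions (suc n)) (llps n)

data IntoBlocks (x : ℕ) : List (List ℕ) → List (List ℕ) → Set where
  here  : ∀ {B B' π} → B' ∈ insertions x B → IntoBlocks x (B ∷ π) (B' ∷ π)
  there : ∀ {B π ρ} → IntoBlocks x π ρ → IntoBlocks x (B ∷ π) (B ∷ ρ)

intoBlocks-view : ∀ {x} π {ρ} → ρ ∈ intoBlocks x π → IntoBlocks x π ρ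
intoBlocks-view {x} (B ∷ π) p with ∈-++⁻ (map (_∷ π) (insertions x B)) p
... | inj₁ q with ∈-map⁻ (_∷ π) q
...   | B' , B'∈ , refl = here B'∈
intoBlocks-view {x} (B ∷ π) p | inj₂ q with ∈-map⁻ (B ∷_) q
...   | ρ' , ρ'∈ , refl = there (intoBlocks-view π ρ'∈)

intoBlocks-member : ∀ {x π ρ} → IntoBlocks x π ρ → ρ ∈ intoBlocks x π
intoBlocks-member {x} (here B'∈)         = ∈-++⁺ˡ (∈-map⁺ (_∷ _) B'∈)
intoBlocks-member {x} {B ∷ π} (there p) = ∈-++⁺ʳ (map (_∷ π) (insertions x B)) (∈-map⁺ (B ∷_) (intoBlocks-member p))

insertions-nonempty : ∀ {x} B {B'} → B' ∈ insertions x B → NonEmpty B'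
insertions-nonempty []      (here refl) = tt
insertions-nonempty (_ ∷ _) (here refl) = tt
insertions-nonempty (y ∷ B) (there p) with ∈-map⁻ (y ∷_) p
... | _ , _ , refl = tt

into-↭ : ∀ {x π ρ} → IntoBlocks x π ρ → concat ρ ↭ x ∷ concat π
into-↭ {π = B ∷ π} (here B'∈) = ++⁺ʳ (concat π) (insertions-↭ B B'∈)
into-↭ {x} {B ∷ π} (there p)  = ↭-trans (++⁺ˡ B (into-↭ p)) (shift x B (concat π))

into-nonempty : ∀ {x π ρ} → All NonEmpty π → IntoBlocks x π ρ → All NonEmpty ρ
into-nonempty {π = B ∷ _} (_ ∷ ne) (here B'∈) = insertions-nonempty B B'∈ ∷ ne
into-nonempty (neB ∷ ne) (there p)             = neB ∷ into-nonempty ne p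

into-length : ∀ {x π ρ} → IntoBlocks x π ρ → length ρ ≡ length π
into-length (here _)  = refl
into-length (there p) = cong suc (into-length p)

into-labels : ∀ {x π ρ} → All NonEmpty π → Below x π → IntoBlocks x π ρ → map label ρ ≡ map label π
into-labels {π = (y ∷ ys) ∷ π} (_ ∷ _) below (here B'∈) =
  cong (_∷ map label π) (label-insertions y ys (<⇒≤ (All.head below)) B'∈)
into-labels {π = B ∷ π} (_ ∷ ne) below (there p) =
  cong (label B ∷_) (into-labels ne (All.++⁻ʳ B below) p)

extensions-sound : ∀ {x π ρ} → All NonEmpty π → ρ ∈ extensions x π →
  All NonEmpty ρ × (concat ρ ↭ x ∷ concat π)
extensions-sound {x} {π} ne p with ∈-++⁻ (insertions [ x ] π) p
... | inj₁ q = All-resp-↭ (↭-sym (insertions-↭ π q)) (tt ∷ ne) , concat-↭ (insertions-↭ π q)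
... | inj₂ q = into-nonempty ne (intoBlocks-view π q) , into-↭ (intoBlocks-view π q)

llps-sound : ∀ n {π} → π ∈ llps n → LLP n π
llps-sound zero    (here refl) = [] , ↭-refl
llps-sound (suc n) p with ∈-concat⁻′ (map (extensions (suc n)) (llps n)) p
... | R , ρ∈R , R∈ with ∈-map⁻ (extensions (suc n)) R∈
...   | π , π∈ , refl with llps-sound n π∈
...     | ne , π↭ with extensions-sound ne ρ∈R
...       | ne' , ρ↭ = ne' , ↭-trans ρ↭ (↭-trans (prep (suc n) π↭) (range1-suc n))

deleteFirst : ℕ → List ℕ → List ℕ
deleteFirst x []       = []
deleteFirst x (y ∷ ys) = if ⌊ y ≟ x ⌋ then ys else y ∷ deleteFirst x ys

deleteFirst-↭ : ∀ {x} B → x ∈ B → B ↭ x ∷ deleteFirst x B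
deleteFirst-↭ {x} (y ∷ ys) x∈ with y ≟ x | x∈
... | yes refl | _         = ↭-refl
... | no y≢x   | here refl = contradiction refl y≢x
... | no _     | there q   = ↭-trans (prep y (deleteFirst-↭ ys q)) (swap y x ↭-refl)

deleteFirst-insertions : ∀ {x} B → x ∈ B → B ∈ insertions x (deleteFirst x B)
deleteFirst-insertions {x} (y ∷ ys) x∈ with y ≟ x | x∈
... | yes refl | _         = head∈insertions y ys
... | no y≢x   | here refl = contradiction refl y≢x
... | no _     | there q   = there (∈-map⁺ (y ∷_) (deleteFirst-insertions ys q))

deleteFirst-head : ∀ x l → deleteFirst x (x ∷ l) ≡ l
deleteFirst-head x l with x ≟ x
... | yes _  = refl
... | no x≢x = contradiction refl x≢x

insertions-deleteFirst : ∀ {x} B → x ∉ B → {B' : List ℕ} → B' ∈ insertions x B → deleteFirst x B' ≡ B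
insertions-deleteFirst {x} []       _  (here refl) = deleteFirst-head x []
insertions-deleteFirst {x} (y ∷ ys) _  (here refl) = deleteFirst-head x (y ∷ ys)
insertions-deleteFirst {x} (y ∷ ys) x∉ (there p) with ∈-map⁻ (y ∷_) p
... | r , r∈ , refl with y ≟ x
...   | yes refl = contradiction (here refl) x∉
...   | no _     = cong (y ∷_) (insertions-deleteFirst ys (x∉ ∘ there) r∈)

consBlock : List ℕ → List (List ℕ) → List (List ℕ)
consBlock []       π = π
consBlock (y ∷ ys) π = (y ∷ ys) ∷ π

concat-consBlock : ∀ l π → concat (consBlock l π) ≡ l ++ concat π
concat-consBlock []      π = refl
concat-consBlock (_ ∷ _) π = refl

-- Remove x from the first block containing it; this inverts the extension step.
removeEntry : ℕ → List (List ℕ) → List (List ℕ)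
removeEntry x []      = []
removeEntry x (B ∷ π) = if ⌊ x ∈? B ⌋ then consBlock (deleteFirst x B) π else B ∷ removeEntry x π

removeEntry-↭ : ∀ {x} π → x ∈ concat π → concat π ↭ x ∷ concat (removeEntry x π)
removeEntry-↭ {x} (B ∷ π) x∈ with x ∈? B
... | yes x∈B = subst (λ w → B ++ concat π ↭ x ∷ w) (sym (concat-consBlock (deleteFirst x B) π))
                      (++⁺ʳ (concat π) (deleteFirst-↭ B x∈B))
... | no x∉B with ∈-++⁻ B x∈
...   | inj₁ q = contradiction q x∉B
...   | inj₂ q = ↭-trans (++⁺ˡ B (removeEntry-↭ π q)) (shift x B _)

removeEntry-nonempty : ∀ {x} π → All NonEmpty π → All NonEmpty (removeEntry x π)
removeEntry-nonempty []      []         = []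
removeEntry-nonempty {x} (B ∷ π) (neB ∷ ne) with x ∈? B | deleteFirst x B
... | yes _ | []     = ne
... | yes _ | _ ∷ _  = tt ∷ ne
... | no _  | _      = neB ∷ removeEntry-nonempty π ne

removeEntry-extension : ∀ {x} π → x ∈ concat π →
  π ∈ insertions [ x ] (removeEntry x π) ⊎ IntoBlocks x (removeEntry x π) π
removeEntry-extension {x} (B ∷ π) x∈ with x ∈? B
... | yes x∈B with deleteFirst x B | deleteFirst-↭ B x∈B | deleteFirst-insertions B x∈B
...   | []    | B↭ | _  with ↭-singleton-inv B↭
...     | refl = inj₁ (head∈insertions [ x ] π)
removeEntry-extension {x} (B ∷ π) x∈ | yes x∈B | _ ∷ _ | _ | B∈ = inj₂ (here B∈)
removeEntry-extension {x} (B ∷ π) x∈ | no x∉B with ∈-++⁻ B x∈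
... | inj₁ q = contradiction q x∉B
... | inj₂ q with removeEntry-extension π q
...   | inj₁ r = inj₁ (there (∈-map⁺ (B ∷_) r))
...   | inj₂ r = inj₂ (there r)

removeEntry-skip : ∀ {x} B ρ → x ∉ B → removeEntry x (B ∷ ρ) ≡ B ∷ removeEntry x ρ
removeEntry-skip {x} B ρ x∉ with x ∈? B
... | yes x∈ = contradiction x∈ x∉
... | no _   = refl

removeEntry-head : ∀ x π → removeEntry x ([ x ] ∷ π) ≡ π
removeEntry-head x π with x ∈? [ x ]
... | yes _  = cong (λ l → consBlock l π) (deleteFirst-head x [])
... | no x∉  = contradiction (here refl) x∉

removeEntry-insertions : ∀ {x} π → x ∉ concat π → {ρ : List (List ℕ)} → ρ ∈ insertions [ x ] π →
  removeEntry x ρ ≡ π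
removeEntry-insertions {x} []      _  (here refl) = removeEntry-head x []
removeEntry-insertions {x} (B ∷ π) _  (here refl) = removeEntry-head x (B ∷ π)
removeEntry-insertions {x} (B ∷ π) x∉ (there p) with ∈-map⁻ (B ∷_) p
... | ρ' , ρ'∈ , refl = trans (removeEntry-skip B ρ' (x∉ ∘ ∈-++⁺ˡ))
                              (cong (B ∷_) (removeEntry-insertions π (x∉ ∘ ∈-++⁺ʳ B) ρ'∈))

-- (the block x was added to is nonempty, so it survives the deletion)
removeEntry-into : ∀ {x π ρ} → x ∉ concat π → All NonEmpty π → IntoBlocks x π ρ → removeEntry x ρ ≡ π
removeEntry-into {x} {(y ∷ ys) ∷ π} x∉ _ (here {B' = B'} B'∈) with x ∈? B'
... | no x∉B' = contradiction (∈-resp-↭ (↭-sym (insertions-↭ (y ∷ ys) B'∈)) (here refl)) x∉B'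
... | yes _   = cong (λ l → consBlock l π) (insertions-deleteFirst (y ∷ ys) (x∉ ∘ ∈-++⁺ˡ) B'∈)
removeEntry-into {x} {B ∷ π} {B ∷ ρ} x∉ (_ ∷ ne) (there p) =
  trans (removeEntry-skip B ρ (x∉ ∘ ∈-++⁺ˡ)) (cong (B ∷_) (removeEntry-into (x∉ ∘ ∈-++⁺ʳ B) ne p))

extensions-removeEntry : ∀ {x π ρ} → x ∉ concat π → All NonEmpty π → ρ ∈ extensions x π → removeEntry x ρ ≡ π
extensions-removeEntry {x} {π} x∉ ne p with ∈-++⁻ (insertions [ x ] π) p
... | inj₁ q = removeEntry-insertions π x∉ q
... | inj₂ q = removeEntry-into x∉ ne (intoBlocks-view π q)

llps-complete : ∀ n {π} → LLP n π → π ∈ llps n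
llps-complete zero    {[]}          _            = here refl
llps-complete zero    {[] ∷ _}      (() ∷ _ , _)
llps-complete zero    {(_ ∷ _) ∷ _} (_ , π↭)     with ↭-length π↭
... | ()
llps-complete (suc n) {π}           (ne , π↭)    =
  ∈-concat⁺′ (extension (removeEntry-extension π x∈))
             (∈-map⁺ (extensions x) (llps-complete n (removeEntry-nonempty π ne , rest↭)))
  where
  x : ℕ
  x = suc n
  x∈ : x ∈ concat π
  x∈ = ∈-resp-↭ (↭-sym π↭) (∈-resp-↭ (range1-suc n) (here refl))
  rest↭ : concat (removeEntry x π) ↭ range1 n
  rest↭ = drop-∷ (↭-trans (↭-sym (removeEntry-↭ π x∈)) (↭-trans π↭ (↭-sym (range1-suc n))))
  extension : π ∈ insertions [ x ] (removeEntry x π) ⊎ IntoBlocks x (removeEntry x π) π →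
              π ∈ extensions x (removeEntry x π)
  extension (inj₁ q) = ∈-++⁺ˡ q
  extension (inj₂ q) = ∈-++⁺ʳ (insertions [ x ] (removeEntry x π)) (intoBlocks-member q)

intoBlocks-unique : ∀ {x} π → x ∉ concat π → Unique (intoBlocks x π)
intoBlocks-unique []          _  = []
intoBlocks-unique {x} (B ∷ π) x∉ =
  Unique.++⁺ (Unique.map⁺ ∷-injectiveˡ (insertions-unique B (x∉ ∘ ∈-++⁺ˡ)))
             (Unique.map⁺ ∷-injectiveʳ (intoBlocks-unique π (x∉ ∘ ∈-++⁺ʳ B)))
             disjoint
  where
  disjoint : ∀ {v} → ¬ (v ∈ map (_∷ π) (insertions x B) × v ∈ map (B ∷_) (intoBlocks x π))
  disjoint (p , q) with ∈-map⁻ (_∷ π) p | ∈-map⁻ (B ∷_) q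
  ... | B' , B'∈ , refl | _ , _ , eq with ∷-injectiveˡ eq
  ...   | refl = x∉ (∈-++⁺ˡ (∈-resp-↭ (↭-sym (insertions-↭ B B'∈)) (here refl)))

-- The two kinds of extension differ in their number of blocks.
extensions-unique : ∀ {x} π → x ∉ concat π → Unique (extensions x π)
extensions-unique {x} π x∉ =
  Unique.++⁺ (insertions-unique π (x∉ ∘ ∈-concat⁺′ (here refl))) (intoBlocks-unique π x∉) disjoint
  where
  disjoint : ∀ {v} → ¬ (v ∈ insertions [ x ] π × v ∈ intoBlocks x π)
  disjoint (p , q) = 1+n≢n (trans (sym (↭-length (insertions-↭ π p))) (into-length (intoBlocks-view π q)))

-- Uniqueness: an extension determines, via removeEntry, the LLP it extends.
llps-unique : ∀ n → Unique (llps n)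
llps-unique zero    = [] ∷ []
llps-unique (suc n) = concatMap-unique (extensions (suc n)) (llps n) (llps-unique n)
  (λ {π} π∈ → extensions-unique π (new π∈))
  (λ π∈ π'∈ p q → trans (sym (extensions-removeEntry (new π∈) (proj₁ (llps-sound n π∈)) p))
                        (extensions-removeEntry (new π'∈) (proj₁ (llps-sound n π'∈)) q))
  where
  new : ∀ {π} → π ∈ llps n → suc n ∉ concat π
  new π∈ n+1∈ = <-irrefl refl (All.lookup (LLP⇒Below (llps-sound n π∈)) n+1∈)

Stats : Set
Stats = ℕ × ℕ × ℕ

stats : List (List ℕ) → Stats
stats π = length π , nsb π , nse π

-- The statistics of the extensions of an LLP of [n] with statistics (a , b , c) by n+1
-- (one more than every entry and label): a new singleton block placed before one of the
-- a blocks is followed by a smaller label (nsb + 1), placed last it is not; n+1 put into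
-- a block before one of the n entries is moved (nse + 1), put at the end of one of the
-- a blocks it is not.
offspring : ℕ → Stats → List Stats
offspring n (a , b , c) =
  replicate a (suc a , suc b , c) ++ [ (suc a , b , c) ] ++ replicate n (a , b , suc c) ++ replicate a (a , b , c)

-- New singleton block: only the position among the blocks matters, and nsb behaves
-- like nMoved on the list of labels, to which the label x is added.
newBlock-stats : ∀ {x} π → All NonEmpty π → Below x π →
  map stats (insertions [ x ] π)
    ≡ replicate (length π) (suc (length π) , suc (nsb π) , nse π) ++ [ (suc (length π) , nsb π , nse π) ]
newBlock-stats {x} π ne below = begin
  map stats ρs                                           ≡⟨ map-cong-local (All.tabulate size-nse) ⟩
  map (λ ρ → (suc a , nsb ρ , c)) ρs                      ≡⟨ map-∘ ρs ⟩
  map (λ e → (suc a , e , c)) (map nsb ρs)                ≡⟨ cong (map (λ e → (suc a , e , c))) nsbs ⟩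
  map (λ e → (suc a , e , c)) (replicate a (suc b) ++ [ b ]) ≡⟨ map-replicate-∷ʳ (λ e → (suc a , e , c)) a (suc b) b ⟩
  replicate a (suc a , suc b , c) ++ [ (suc a , b , c) ] ∎
  where
  open ≡-Reasoning
  ρs : List (List (List ℕ))
  a b c : ℕ
  ρs = insertions [ x ] π
  a = length π
  b = nsb π
  c = nse π
  size-nse : ∀ {ρ} → ρ ∈ ρs → stats ρ ≡ (suc a , nsb ρ , c)
  size-nse {ρ} ρ∈ = cong₂ (λ u w → u , nsb ρ , w) (↭-length (insertions-↭ π ρ∈))
                                                  (sum-↭ (map⁺ nMoved (insertions-↭ π ρ∈)))
  labels-below : All (_< x) (map label π)
  labels-below = All.map⁺ (labels ne below)
    where
    labels : ∀ {π} → All NonEmpty π → Below x π → All (λ B → label B < x) π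
    labels {[]}           []      _     = []
    labels {(y ∷ ys) ∷ π} (_ ∷ ne) below =
      All.lookup below (∈-++⁺ˡ (label-∈ y ys)) ∷ labels ne (All.++⁻ʳ (y ∷ ys) below)
  nsbs : map nsb ρs ≡ replicate a (suc b) ++ [ b ]
  nsbs = begin
    map nsb ρs                                      ≡⟨ map-∘ ρs ⟩
    map nMoved (map (map label) ρs)                 ≡⟨ cong (map nMoved) (insertions-map label [ x ] π) ⟩
    map nMoved (insertions x (map label π))         ≡⟨ nMoved-insertions (map label π) labels-below ⟩
    replicate (length (map label π)) (suc b) ++ [ b ] ≡⟨ cong (λ k → replicate k (suc b) ++ [ b ]) (length-map label π) ⟩
    replicate a (suc b) ++ [ b ]                    ∎

-- Adding x into the blocks: by nMoved-insertions, a block B contributes |B| extensions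
-- with one more moved entry and one without.
intoBlocks-nse : ∀ {x} π → Below x π →
  map nse (intoBlocks x π) ↭ replicate (length (concat π)) (suc (nse π)) ++ replicate (length π) (nse π)
intoBlocks-nse []          _     = ↭-refl
intoBlocks-nse {x} (B ∷ π) below = begin
  map nse (map (_∷ π) (insertions x B) ++ map (B ∷_) (intoBlocks x π))
    ≡⟨ map-++ nse (map (_∷ π) (insertions x B)) _ ⟩
  map nse (map (_∷ π) (insertions x B)) ++ map nse (map (B ∷_) (intoBlocks x π))
    ≡⟨ cong₂ _++_ (trans (sym (map-∘ (insertions x B))) (map-∘ (insertions x B)))
                  (trans (sym (map-∘ (intoBlocks x π))) (map-∘ (intoBlocks x π))) ⟩
  map (_+ s) (map nMoved (insertions x B)) ++ map (m +_) (map nse (intoBlocks x π))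
    ≡⟨ cong (_++ map (m +_) (map nse (intoBlocks x π)))
            (trans (cong (map (_+ s)) (nMoved-insertions B (All.++⁻ˡ B below)))
                   (map-replicate-∷ʳ (_+ s) (length B) (suc m) m)) ⟩
  (replicate (length B) (suc (m + s)) ++ [ m + s ]) ++ map (m +_) (map nse (intoBlocks x π))
    ≡⟨ List.++-assoc (replicate (length B) (suc (m + s))) [ m + s ] _ ⟩
  replicate (length B) (suc (m + s)) ++ (m + s) ∷ map (m +_) (map nse (intoBlocks x π))
    ↭⟨ ++⁺ˡ (replicate (length B) _) (prep (m + s) (map⁺ (m +_) (intoBlocks-nse π (All.++⁻ʳ B below)))) ⟩
  replicate (length B) (suc (m + s)) ++ (m + s) ∷ map (m +_) (replicate N (suc s) ++ replicate a s)
    ≡⟨ cong (λ l → replicate (length B) (suc (m + s)) ++ (m + s) ∷ l) shifted ⟩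
  replicate (length B) (suc (m + s)) ++ (m + s) ∷ (replicate N (suc (m + s)) ++ replicate a (m + s))
    ↭⟨ regroup (length B) N a (suc (m + s)) (m + s) ⟩
  replicate (length B + N) (suc (m + s)) ++ replicate (suc a) (m + s)
    ≡⟨ cong (λ k → replicate k (suc (m + s)) ++ replicate (suc a) (m + s)) (sym (length-++ B)) ⟩
  replicate (length (B ++ concat π)) (suc (m + s)) ++ replicate (suc a) (m + s) ∎
  where
  open PermutationReasoning
  m s N a : ℕ
  m = nMoved B
  s = nse π
  N = length (concat π)
  a = length π
  shifted : map (m +_) (replicate N (suc s) ++ replicate a s) ≡ replicate N (suc (m + s)) ++ replicate a (m + s)
  shifted = trans (map-++ (m +_) (replicate N (suc s)) (replicate a s))
                  (cong₂ _++_ (trans (map-replicate (m +_) N (suc s)) (cong (replicate N) (+-suc m s)))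
                              (map-replicate (m +_) a s))

-- The number of blocks and the labels (hence nsb) are unchanged.
intoBlocks-stats : ∀ {x} π → All NonEmpty π → Below x π →
  map stats (intoBlocks x π)
    ↭ replicate (length (concat π)) (length π , nsb π , suc (nse π)) ++ replicate (length π) (length π , nsb π , nse π)
intoBlocks-stats {x} π ne below = begin
  map stats (intoBlocks x π)                    ≡⟨ map-cong-local (All.tabulate same-shape) ⟩
  map (λ ρ → (a , b , nse ρ)) (intoBlocks x π)  ≡⟨ map-∘ (intoBlocks x π) ⟩
  map (λ e → (a , b , e)) (map nse (intoBlocks x π))
    ↭⟨ map⁺ (λ e → (a , b , e)) (intoBlocks-nse π below) ⟩
  map (λ e → (a , b , e)) (replicate N (suc (nse π)) ++ replicate a (nse π))
    ≡⟨ map-++ (λ e → (a , b , e)) (replicate N _) (replicate a _) ⟩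
  map (λ e → (a , b , e)) (replicate N (suc (nse π))) ++ map (λ e → (a , b , e)) (replicate a (nse π))
    ≡⟨ cong₂ _++_ (map-replicate (λ e → (a , b , e)) N _) (map-replicate (λ e → (a , b , e)) a _) ⟩
  replicate N (a , b , suc (nse π)) ++ replicate a (a , b , nse π) ∎
  where
  open PermutationReasoning
  a b N : ℕ
  a = length π
  b = nsb π
  N = length (concat π)
  same-shape : ∀ {ρ} → ρ ∈ intoBlocks x π → stats ρ ≡ (a , b , nse ρ)
  same-shape {ρ} ρ∈ = cong₂ (λ u v → u , v , nse ρ) (into-length (intoBlocks-view π ρ∈))
                            (cong nMoved (into-labels ne below (intoBlocks-view π ρ∈)))

extensions-stats : ∀ n π → LLP n π → map stats (extensions (suc n) π) ↭ offspring n (stats π)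
extensions-stats n π llp@(ne , π↭) = begin
  map stats (insertions [ x ] π ++ intoBlocks x π)               ≡⟨ map-++ stats (insertions [ x ] π) _ ⟩
  map stats (insertions [ x ] π) ++ map stats (intoBlocks x π)
    ≡⟨ cong (_++ map stats (intoBlocks x π)) (newBlock-stats π ne below) ⟩
  (replicate a (suc a , suc b , c) ++ [ (suc a , b , c) ]) ++ map stats (intoBlocks x π)
    ≡⟨ List.++-assoc (replicate a (suc a , suc b , c)) _ _ ⟩
  replicate a (suc a , suc b , c) ++ (suc a , b , c) ∷ map stats (intoBlocks x π)
    ↭⟨ ++⁺ˡ (replicate a _) (prep _ (intoBlocks-stats π ne below)) ⟩
  replicate a (suc a , suc b , c) ++ (suc a , b , c) ∷ (replicate N (a , b , suc c) ++ replicate a (a , b , c))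
    ≡⟨ cong (λ k → replicate a (suc a , suc b , c) ++ (suc a , b , c) ∷ (replicate k (a , b , suc c) ++ replicate a (a , b , c)))
            N≡n ⟩
  offspring n (stats π) ∎
  where
  open PermutationReasoning
  x a b c N : ℕ
  x = suc n
  a = length π
  b = nsb π
  c = nse π
  N = length (concat π)
  below : Below x π
  below = LLP⇒Below llp
  N≡n : N ≡ n
  N≡n = trans (↭-length π↭) (trans (length-map suc (upTo n)) (length-upTo n))

_≟ˢ_ : DecidableEquality Stats
_≟ˢ_ = ≡-dec _≟_ (≡-dec _≟_ _≟_)

open Multiplicity _≟ˢ_

distribution : ℕ → Stats → ℕ
distribution n t = count t (map stats (llps n))

-- The parents of an LLP of [n+1] with statistics (K , I , J), as weighted statistics
-- read off from offspring: a new block that is not last (K , I ≥ 1, weight K - 1),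
-- a new last block (K ≥ 1), an entry put into a block before another one (J ≥ 1,
-- weight n), an entry put at the end of one of the K blocks.
newBlockEarly : ℕ → ℕ → ℕ → List (ℕ × Stats)
newBlockEarly (suc K) (suc I) J = [ (K , (K , I , J)) ]
newBlockEarly _       _       _ = []

newBlockLast : ℕ → ℕ → ℕ → List (ℕ × Stats)
newBlockLast (suc K) I J = [ (1 , (K , I , J)) ]
newBlockLast zero    _ _ = []

intoBlockEarly : ℕ → ℕ → ℕ → ℕ → List (ℕ × Stats)
intoBlockEarly n K I (suc J) = [ (n , (K , I , J)) ]
intoBlockEarly n K I zero    = []

predecessors : ℕ → Stats → List (ℕ × Stats)
predecessors n (K , I , J) =
  newBlockEarly K I J ++ newBlockLast K I J ++ intoBlockEarly n K I J ++ [ (K , (K , I , J)) ]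

weighted-predecessors : ∀ f n K I J → weighted f (predecessors n (K , I , J)) ≡
  weighted f (newBlockEarly K I J) + weighted f (newBlockLast K I J) + (weighted f (intoBlockEarly n K I J) + K * f (K , I , J))
weighted-predecessors f n K I J = begin
  weighted f (E ++ L ++ Is ++ [ (K , t) ])            ≡⟨ weighted-++ f E _ ⟩
  weighted f E + weighted f (L ++ Is ++ [ (K , t) ])  ≡⟨ cong (weighted f E +_) (weighted-++ f L _) ⟩
  weighted f E + (weighted f L + weighted f (Is ++ [ (K , t) ]))
    ≡⟨ sym (+-assoc (weighted f E) (weighted f L) _) ⟩
  weighted f E + weighted f L + weighted f (Is ++ [ (K , t) ])
    ≡⟨ cong (weighted f E + weighted f L +_) (trans (weighted-++ f Is _) (cong (weighted f Is +_) (+-identityʳ (K * f t)))) ⟩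
  weighted f E + weighted f L + (weighted f Is + K * f t) ∎
  where
  open ≡-Reasoning
  t : Stats
  E L Is : List (ℕ × Stats)
  t = (K , I , J)
  E = newBlockEarly K I J
  L = newBlockLast K I J
  Is = intoBlockEarly n K I J

-- offspring and predecessors describe the same relation: the number of offspring of τ
-- with statistics t is the weight of τ among the predecessors of t.
offspring-count : ∀ n τ t → count t (offspring n τ) ≡ weighted (λ u → count u [ τ ]) (predecessors n t)
offspring-count n τ@(a , b , c) t@(K , I , J) = begin
  count t (replicate a P ++ [ Q ] ++ replicate n R ++ replicate a τ)
    ≡⟨ count-++ t (replicate a P) _ ⟩
  count t (replicate a P) + count t ([ Q ] ++ replicate n R ++ replicate a τ)
    ≡⟨ cong (count t (replicate a P) +_) (trans (count-++ t [ Q ] _) (cong (count t [ Q ] +_) (count-++ t (replicate n R) _))) ⟩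
  count t (replicate a P) + (count t [ Q ] + (count t (replicate n R) + count t (replicate a τ)))
    ≡⟨ sym (+-assoc (count t (replicate a P)) _ _) ⟩
  count t (replicate a P) + count t [ Q ] + (count t (replicate n R) + count t (replicate a τ))
    ≡⟨ cong₂ _+_ (cong₂ _+_ (trans (count-replicate t a P) (early K I J)) (last K I J))
                 (cong₂ _+_ (trans (count-replicate t n R) (into J)) (trans (count-replicate t a τ) stay)) ⟩
  weighted δ (newBlockEarly K I J) + weighted δ (newBlockLast K I J) + (weighted δ (intoBlockEarly n K I J) + K * δ t)
    ≡⟨ sym (weighted-predecessors δ n K I J) ⟩
  weighted δ (predecessors n t) ∎
  where
  open ≡-Reasoning
  P Q R : Stats
  P = (suc a , suc b , c)
  Q = (suc a , b , c)
  R = (a , b , suc c)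
  δ : Stats → ℕ
  δ u = count u [ τ ]
  early : ∀ K I J → a * count (K , I , J) [ P ] ≡ weighted δ (newBlockEarly K I J)
  early (suc K) (suc I) J = begin
    a * count (suc K , suc I , J) [ P ]
      ≡⟨ cong (a *_) (count-single-injective (λ (x , y , z) → (suc x , suc y , z)) (λ { refl → refl }) τ (K , I , J)) ⟩
    a * δ (K , I , J) ≡⟨ count-single-weight proj₁ τ (K , I , J) ⟩
    K * δ (K , I , J) ≡⟨ sym (+-identityʳ _) ⟩
    K * δ (K , I , J) + 0 ∎
  early zero    I       J = trans (cong (a *_) (count-single-≢ {P} {zero , I , J} λ ())) (*-zeroʳ a)
  early (suc K) zero    J = trans (cong (a *_) (count-single-≢ {P} {suc K , zero , J} λ ())) (*-zeroʳ a)
  last : ∀ K I J → count (K , I , J) [ Q ] ≡ weighted δ (newBlockLast K I J)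
  last (suc K) I J = trans (count-single-injective (λ (x , y , z) → (suc x , y , z)) (λ { refl → refl }) τ (K , I , J))
                           (sym (trans (+-identityʳ _) (*-identityˡ _)))
  last zero    I J = count-single-≢ {Q} {zero , I , J} λ ()
  into : ∀ J → n * count (K , I , J) [ R ] ≡ weighted δ (intoBlockEarly n K I J)
  into (suc J) = trans (cong (n *_) (count-single-injective (λ (x , y , z) → (x , y , suc z)) (λ { refl → refl }) τ (K , I , J)))
                       (sym (+-identityʳ _))
  into zero    = trans (cong (n *_) (count-single-≢ {R} {K , I , zero} λ ())) (*-zeroʳ n)
  stay : a * δ t ≡ K * δ t
  stay = count-single-weight proj₁ τ t

distribution-step : ∀ n t → distribution (suc n) t ≡ weighted (distribution n) (predecessors n t)
distribution-step n t = begin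
  count t (map stats (concatMap (extensions (suc n)) (llps n)))
    ≡⟨ cong (count t) (List.map-concatMap stats (extensions (suc n)) (llps n)) ⟩
  count t (concatMap (map stats ∘ extensions (suc n)) (llps n))
    ≡⟨ count-concatMap (map stats ∘ extensions (suc n)) stats (predecessors n) (llps n) rule t ⟩
  weighted (distribution n) (predecessors n t) ∎
  where
  open ≡-Reasoning
  rule : ∀ {π} → π ∈ llps n → ∀ t →
         count t (map stats (extensions (suc n) π)) ≡ weighted (λ u → count u [ stats π ]) (predecessors n t)
  rule {π} π∈ t = trans (count-↭ t (extensions-stats n π (llps-sound n π∈))) (offspring-count n (stats π) t)

-- [n , n - j] as a function of j: the permutations of [n] with j entries followed by a
-- smaller one. Inserting n+1 in front of one of the n entries creates such an entry,
-- appending it does not.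
stirlingCo : ℕ → ℕ → ℕ
stirlingCo zero    zero    = 1
stirlingCo zero    (suc j) = 0
stirlingCo (suc n) zero    = stirlingCo n zero
stirlingCo (suc n) (suc j) = stirlingCo n (suc j) + n * stirlingCo n j

-- The LLPs of [m] with k blocks, all of them increasing lists, and nsb = i: a set
-- partition of [m] into k blocks, times an ordering of the blocks by their labels.
increasing : ℕ → ℕ → ℕ → ℕ
increasing m k i = stirling2 m k * stirlingCo k i

-- The claimed count [n , n - j] {n - j , k} [k , k - i], with the last two factors
-- grouped as increasing (n - j) k i.
closedForm : ℕ → Stats → ℕ
closedForm n (k , i , j) = stirlingCo n j * increasing (n ∸ j) k i

-- The recurrence for increasing LLPs: m+1 forms a new block (early or last) or is put at
-- the end of one of the k blocks; scaled by a factor E and read through any f that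
-- agrees with E · increasing m.
increasing-step : ∀ E m K I J (f : Stats → ℕ) → (∀ K' I' → f (K' , I' , J) ≡ E * increasing m K' I') →
  E * increasing (suc m) K I ≡ weighted f (newBlockEarly K I J) + weighted f (newBlockLast K I J) + K * f (K , I , J)
increasing-step E m zero    I       J f agree = *-zeroʳ E
increasing-step E m (suc K) zero    J f agree rewrite agree K zero | agree (suc K) zero =
  new-last-or-append E K (stirling2 m (suc K)) (stirling2 m K) (stirlingCo K zero)
  where
  new-last-or-append : ∀ E K A B c → E * ((suc K * A + B) * c) ≡ 0 + (1 * (E * (B * c)) + 0) + suc K * (E * (A * c))
  new-last-or-append = solve-∀
increasing-step E m (suc K) (suc I) J f agree rewrite agree K I | agree K (suc I) | agree (suc K) (suc I) =
  new-early-last-or-append E K (stirling2 m (suc K)) (stirling2 m K) (stirlingCo K (suc I)) (stirlingCo K I)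
  where
  new-early-last-or-append : ∀ E K A B c d →
    E * ((suc K * A + B) * (c + K * d)) ≡ (K * (E * (B * d)) + 0) + (1 * (E * (B * c)) + 0) + suc K * (E * (A * (c + K * d)))
  new-early-last-or-append = solve-∀

-- Permutations of [n] have fewer than n + 1 moved entries.
stirlingCo-vanish : ∀ {n j} → n < j → stirlingCo n j ≡ 0
stirlingCo-vanish {zero}  {suc j} _         = refl
stirlingCo-vanish {suc n} {suc j} (s≤s n<j) =
  trans (cong₂ (λ x y → x + n * y) (stirlingCo-vanish (m<n⇒m<1+n n<j)) (stirlingCo-vanish n<j)) (*-zeroʳ n)

∸-unfold : ∀ {n j} → j < n → n ∸ j ≡ suc (n ∸ suc j)
∸-unfold {suc n} {zero}  _         = refl
∸-unfold {suc n} {suc j} (s≤s j<n) = ∸-unfold j<n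

-- If n < j + 1 the factor [n , n - (j + 1)] vanishes, so n - j may be read as 1 + (n - (j + 1)).
stirlingCo-∸ : ∀ n j (g : ℕ → ℕ) → stirlingCo n (suc j) * g (n ∸ j) ≡ stirlingCo n (suc j) * g (suc (n ∸ suc j))
stirlingCo-∸ n j g with j <? n
... | yes j<n = cong (λ m → stirlingCo n (suc j) * g m) (∸-unfold j<n)
... | no j≮n rewrite stirlingCo-vanish {n} {suc j} (s≤s (≮⇒≥ j≮n)) = refl

closedForm-step : ∀ n t → closedForm (suc n) t ≡ weighted (closedForm n) (predecessors n t)
closedForm-step n (K , I , zero) =
  trans (increasing-step (stirlingCo n 0) n K I 0 (closedForm n) (λ _ _ → refl))
        (sym (weighted-predecessors (closedForm n) n K I 0))
closedForm-step n (K , I , suc J) = begin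
  (E + n * stirlingCo n J) * increasing (n ∸ J) K I
    ≡⟨ split E n (stirlingCo n J) (increasing (n ∸ J) K I) ⟩
  E * increasing (n ∸ J) K I + n * closedForm n (K , I , J)
    ≡⟨ cong (_+ n * closedForm n (K , I , J)) (stirlingCo-∸ n J (λ m → increasing m K I)) ⟩
  E * increasing (suc (n ∸ suc J)) K I + n * closedForm n (K , I , J)
    ≡⟨ cong (_+ n * closedForm n (K , I , J)) (increasing-step E (n ∸ suc J) K I (suc J) (closedForm n) (λ _ _ → refl)) ⟩
  early + last + K * closedForm n (K , I , suc J) + n * closedForm n (K , I , J)
    ≡⟨ reorder early last (K * closedForm n (K , I , suc J)) (n * closedForm n (K , I , J)) ⟩
  early + last + ((n * closedForm n (K , I , J) + 0) + K * closedForm n (K , I , suc J))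
    ≡⟨ sym (weighted-predecessors (closedForm n) n K I (suc J)) ⟩
  weighted (closedForm n) (predecessors n (K , I , suc J)) ∎
  where
  open ≡-Reasoning
  E early last : ℕ
  E = stirlingCo n (suc J)
  early = weighted (closedForm n) (newBlockEarly K I (suc J))
  last  = weighted (closedForm n) (newBlockLast K I (suc J))
  split : ∀ e n c x → (e + n * c) * x ≡ e * x + n * (c * x)
  split = solve-∀
  reorder : ∀ a b c d → a + b + c + d ≡ a + b + ((d + 0) + c)
  reorder = solve-∀

distribution-zero : ∀ t → distribution 0 t ≡ closedForm 0 t
distribution-zero (zero  , zero  , zero)  = refl
distribution-zero (zero  , suc I , zero)  = count-single-≢ {(0 , 0 , 0)} {(0 , suc I , 0)} λ ()
distribution-zero (suc K , I     , zero)  = count-single-≢ {(0 , 0 , 0)} {(suc K , I , 0)} λ ()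
distribution-zero (K     , I     , suc J) = count-single-≢ {(0 , 0 , 0)} {(K , I , suc J)} λ ()

distribution≡closedForm : ∀ n t → distribution n t ≡ closedForm n t
distribution≡closedForm zero    t = distribution-zero t
distribution≡closedForm (suc n) t = begin
  distribution (suc n) t                         ≡⟨ distribution-step n t ⟩
  weighted (distribution n) (predecessors n t)   ≡⟨ weighted-cong (distribution≡closedForm n) (predecessors n t) ⟩
  weighted (closedForm n) (predecessors n t)     ≡⟨ sym (closedForm-step n t) ⟩
  closedForm (suc n) t                           ∎
  where open ≡-Reasoning

-- A permutation of [n] has at most n cycles, and at least one if n ≥ 1.
stirling1-vanish : ∀ {n m} → n < m → stirling1 n m ≡ 0
stirling1-vanish {zero}  {suc m} _         = refl
stirling1-vanish {suc n} {suc m} (s≤s n<m) =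
  trans (cong₂ (λ x y → n * x + y) (stirling1-vanish (m<n⇒m<1+n n<m)) (stirling1-vanish n<m))
        (trans (+-identityʳ (n * 0)) (*-zeroʳ n))

stirling1-no-cycles : ∀ {n} → 1 ≤ n → stirling1 n 0 ≡ 0
stirling1-no-cycles {suc n} _ = refl

stirlingCo≡stirling1 : ∀ n j → j ≤ n → stirlingCo n j ≡ stirling1 n (n ∸ j)
stirlingCo≡stirling1 zero    zero    _ = refl
stirlingCo≡stirling1 (suc n) zero    _
  rewrite stirlingCo≡stirling1 n zero z≤n | stirling1-vanish {n} {suc n} ≤-refl | *-zeroʳ n = refl
stirlingCo≡stirling1 (suc n) (suc j) (s≤s j≤n) with m≤n⇒m<n∨m≡n j≤n
... | inj₂ refl rewrite stirlingCo-vanish {j} {suc j} ≤-refl | stirlingCo≡stirling1 j j ≤-refl | n∸n≡0 j = none-fixed j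
  where
  none-fixed : ∀ j → j * stirling1 j 0 ≡ 0
  none-fixed zero    = refl
  none-fixed (suc j) = *-zeroʳ (suc j)
... | inj₁ j<n rewrite ∸-unfold j<n | stirlingCo≡stirling1 n (suc j) j<n | stirlingCo≡stirling1 n j j≤n | ∸-unfold j<n =
  +-comm (stirling1 n (n ∸ suc j)) _

-- For n ≥ 1 the identification holds for every j: both sides vanish when j > n.
stirlingCo≡stirling1-pos : ∀ n j → 1 ≤ n → stirlingCo n j ≡ stirling1 n (n ∸ j)
stirlingCo≡stirling1-pos n j 1≤n with j ≤? n
... | yes j≤n = stirlingCo≡stirling1 n j j≤n
... | no j≰n  rewrite stirlingCo-vanish (≰⇒> j≰n) | m≤n⇒m∸n≡0 (<⇒≤ (≰⇒> j≰n)) = sym (stirling1-no-cycles 1≤n)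

closedForm≡stirling : ∀ n k i j → 1 ≤ k → k ≤ n →
  closedForm n (k , i , j) ≡ stirling1 n (n ∸ j) * stirling2 (n ∸ j) k * stirling1 k (k ∸ i)
closedForm≡stirling n k i j 1≤k k≤n = begin
  stirlingCo n j * (stirling2 (n ∸ j) k * stirlingCo k i) ≡⟨ sym (*-assoc (stirlingCo n j) _ _) ⟩
  stirlingCo n j * stirling2 (n ∸ j) k * stirlingCo k i
    ≡⟨ cong₂ (λ x y → x * stirling2 (n ∸ j) k * y) (stirlingCo≡stirling1-pos n j (≤-trans 1≤k k≤n))
                                                   (stirlingCo≡stirling1-pos k i 1≤k) ⟩
  stirling1 n (n ∸ j) * stirling2 (n ∸ j) k * stirling1 k (k ∸ i) ∎
  where open ≡-Reasoning

mainTheorem5 : (n k i j : ℕ) → 1 ≤ k → k ≤ n →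
    Σ (List (List (List ℕ))) (λ L →
      Unique L
      × ((π : List (List ℕ)) → (π ∈ L) ⇔ (IsLLP n k π × nsb π ≡ i × nse π ≡ j))
      × length L ≡ stirling1 n (n ∸ j) * stirling2 (n ∸ j) k * stirling1 k (k ∸ i))
mainTheorem5 n k i j 1≤k k≤n = L , Unique.filter⁺ wanted? (llps-unique n) , members , size
  where
  wanted? : (π : List (List ℕ)) → Dec (stats π ≡ (k , i , j))
  wanted? π = stats π ≟ˢ (k , i , j)
  L : List (List (List ℕ))
  L = filter wanted? (llps n)
  members : (π : List (List ℕ)) → (π ∈ L) ⇔ (IsLLP n k π × nsb π ≡ i × nse π ≡ j)
  members π = mk⇔ to from
    where
    to : π ∈ L → IsLLP n k π × nsb π ≡ i × nse π ≡ j
    to π∈ with ∈-filter⁻ wanted? π∈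
    ... | π∈llps , refl with llps-sound n π∈llps
    ...   | ne , π↭ = (refl , ne , π↭) , refl , refl
    from : IsLLP n k π × nsb π ≡ i × nse π ≡ j → π ∈ L
    from ((refl , ne , π↭) , refl , refl) = ∈-filter⁺ wanted? (llps-complete n (ne , π↭)) refl
  size : length L ≡ stirling1 n (n ∸ j) * stirling2 (n ∸ j) k * stirling1 k (k ∸ i)
  size = begin
    length L                    ≡⟨ count-map stats (llps n) (k , i , j) ⟩
    distribution n (k , i , j)  ≡⟨ distribution≡closedForm n (k , i , j) ⟩
    closedForm n (k , i , j)    ≡⟨ closedForm≡stirling n k i j 1≤k k≤n ⟩
    stirling1 n (n ∸ j) * stirling2 (n ∸ j) k * stirling1 k (k ∸ i) ∎
    where open ≡-Reasoning
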